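{- For any nominal transition system $\mathbf T$ with a distinguished action $\tau$ and states $P,Q$: if $P\stackrel{\cdot}{\approx}_{\mathcal S(\mathbf T)}Q$ then $P\stackrel{\cdot}{\approx}_{\mathbf T}Q$.
   Context: Nominal sets over a countably infinite (possibly sorted) set of names $\mathcal N$: permutations fix all but finitely many names; every element has finite support $\operatorname{supp}$; $a\# X$ means $a\notin\operatorname{supp}(X)$; $[\mathcal P_{\mathrm{fin}}(\mathcal N)]S$ is $\mathcal P_{\mathrm{fin}}(\mathcal N)\times S$ modulo $(N,X)=_\alpha(N',X')$ iff some $\pi$ with $\pi\cdot(N,X)=(N',X')$ fixes every name of $\operatorname{supp}(X)\setminus N$; classes $\langle N\rangle X$. A nominal transition system: nominal sets STATES, PRED, ACT; equivariant $\vdash\subseteq\mathrm{STATES}\times\mathrm{PRED}$; equivariant $\operatorname{bn}$, $\operatorname{bn}(\alpha)$ a finite subset of $\operatorname{supp}(\alpha)$; equivariant $\rightarrow\ \subseteq\mathrm{STATES}\times[\mathcal P_{\mathrm{fin}}(\mathcal N)](\mathrm{ACT}\times\mathrm{STATES})$ with $(P,\langle N\rangle(\alpha,Q))\in\rightarrow$ only if $N=\operatorname{bn}(\alpha)$; $P\xrightarrow{\alpha}P'$ means $(P,\langle\operatorname{bn}(\alpha)\rangle(\alpha,P'))\in\rightarrow$. $\tau\in\mathrm{ACT}$ is a special action with empty support. Weak transitions: $P\Rightarrow P'$ iff $P=P'$ or $P\xrightarrow{\tau}P''\Rightarrow P'$; $P\stackrel{\alpha}{\Rightarrow}P'$ iff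 $P\Rightarrow\circ\xrightarrow{\alpha}\circ\Rightarrow P'$; $P\stackrel{\hat\alpha}{\Rightarrow}P'$ is $P\Rightarrow P'$ if $\alpha=\tau$, else $P\stackrel{\alpha}{\Rightarrow}P'$. A weak bisimulation is a symmetric relation $R$ with: $R(P,Q)$ implies (weak simulation) whenever $\operatorname{bn}(\alpha)\# Q$ and $P\xrightarrow{\alpha}P'$, some $Q'$ has $Q\stackrel{\hat\alpha}{\Rightarrow}Q'$ and $R(P',Q')$; (weak static implication) whenever $P\vdash\varphi$, some $Q'$ has $Q\Rightarrow Q'$, $Q'\vdash\varphi$, $R(P,Q')$. $\stackrel{\cdot}{\approx}_{\mathbf T}$ is weak bisimilarity in $\mathbf T$. $\mathcal S(\mathbf T)$ is the nominal transition system with: same states as $\mathbf T$; actions $\mathrm{ACT}_{\mathbf T}\uplus\mathrm{PRED}_{\mathbf T}$ (so $\tau$ is also its distinguished action); $\operatorname{bn}$ as in $\mathbf T$ on $\mathrm{ACT}_{\mathbf T}$ and $\operatorname{bn}(\varphi)=\emptyset$ for $\varphi\in\mathrm{PRED}_{\mathbf T}$; no state predicates hold; transitions $P\xrightarrow{\alpha}P'$ iff $P\xrightarrow{\alpha}P'$ in $\mathbf T$ (for $\alpha\in\mathrm{ACT}_{\mathbf T}$), and $P\xrightarrow{\varphi}P$ iff $P\vdash_{\mathbf T}\varphi$, with no other $\varphi$-transitions. -}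

module Defs where

open import Data.Product using (Σ; _×_; _,_; proj₁; proj₂; ∃; ∃₂)
open import Data.Product.Properties using (≡-dec)
open import Data.Sum using (_⊎_; inj₁; inj₂)
open import Data.List using (List; []; _∷_; _++_; map)
open import Data.List.Membership.Propositional using (_∈_; _∉_)
open import Data.Nat using (ℕ)
import Data.Nat.Properties as ℕₚ
open import Data.Empty using (⊥; ⊥-elim)
open import Relation.Nullary using (¬_; yes; no)
open import Relation.Binary.PropositionalEquality
open import Relation.Binary.Definitions using (DecidableEquality)

-- Names are  Sort × ℕ : countably infinitely many names of each sort
-- (the unsorted case is Sort = ⊤).  Permutations are represented by
-- finite lists of sort-preserving transpositions; these generate exactly
-- the finitely supported sort-preserving permutations of names.

module NominalTheory (Sort : Set) (_≟S_ : DecidableEquality Sort) where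

  Name : Set
  Name = Sort × ℕ

  sort : Name → Sort
  sort = proj₁

  _≟N_ : DecidableEquality Name
  _≟N_ = ≡-dec _≟S_ ℕₚ._≟_

  Swap : Set
  Swap = Σ (Name × Name) (λ ab → sort (proj₁ ab) ≡ sort (proj₂ ab))

  swap : Swap → Name → Name
  swap ((a , b) , _) c with c ≟N a
  ... | yes _ = b
  ... | no _ with c ≟N b
  ...   | yes _ = a
  ...   | no _ = c

  -- finite composition of transpositions;  (π ++ σ) acts as π ∘ σ
  Perm : Set
  Perm = List Swap

  perm : Perm → Name → Name
  perm [] a = a
  perm (s ∷ π) a = swap s (perm π a)

  record Nominal : Set₁ where
    field
      Carrier : Set
      act     : Perm → Carrier → Carrier
      act-id  : ∀ x → act [] x ≡ x
      act-comp : ∀ π σ x → act (π ++ σ) x ≡ act π (act σ x)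
      act-ext : ∀ π σ → (∀ a → perm π a ≡ perm σ a) → ∀ x → act π x ≡ act σ x
      supp    : Carrier → List Name
      supp-supports : ∀ x π → (∀ a → a ∈ supp x → perm π a ≡ a) → act π x ≡ x
      supp-least : ∀ x (A : List Name)
                 → (∀ π → (∀ a → a ∈ A → perm π a ≡ a) → act π x ≡ x)
                 → ∀ a → a ∈ supp x → a ∈ A

  open Nominal

  _⊎ᴺ_ : Nominal → Nominal → Nominal
  A ⊎ᴺ B = record
    { Carrier = Carrier A ⊎ Carrier B
    ; act = ac
    ; act-id = λ { (inj₁ x) → cong inj₁ (act-id A x) ; (inj₂ y) → cong inj₂ (act-id B y) }
    ; act-comp = λ { π σ (inj₁ x) → cong inj₁ (act-comp A π σ x)
                   ; π σ (inj₂ y) → cong inj₂ (act-comp B π σ y) }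
    ; act-ext = λ { π σ e (inj₁ x) → cong inj₁ (act-ext A π σ e x)
                  ; π σ e (inj₂ y) → cong inj₂ (act-ext B π σ e y) }
    ; supp = sp
    ; supp-supports = λ { (inj₁ x) π h → cong inj₁ (supp-supports A x π h)
                        ; (inj₂ y) π h → cong inj₂ (supp-supports B y π h) }
    ; supp-least = λ { (inj₁ x) L h → supp-least A x L (λ π f → inj₁-inj (h π f))
                     ; (inj₂ y) L h → supp-least B y L (λ π f → inj₂-inj (h π f)) }
    }
    where
    ac : Perm → Carrier A ⊎ Carrier B → Carrier A ⊎ Carrier B
    ac π (inj₁ x) = inj₁ (act A π x)
    ac π (inj₂ y) = inj₂ (act B π y)
    sp : Carrier A ⊎ Carrier B → List Name
    sp (inj₁ x) = supp A x
    sp (inj₂ y) = supp B y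
    inj₁-inj : ∀ {x y : Carrier A} → _≡_ {A = Carrier A ⊎ Carrier B} (inj₁ x) (inj₁ y) → x ≡ y
    inj₁-inj refl = refl
    inj₂-inj : ∀ {x y : Carrier B} → _≡_ {A = Carrier A ⊎ Carrier B} (inj₂ x) (inj₂ y) → x ≡ y
    inj₂-inj refl = refl

  -- A transition is an element (P, ⟨bn α⟩(α,P')) of
  -- STATES × [P_fin(N)](ACT × STATES); we represent → by the relation
  -- P ─ α ⟶ P'  ("(P, ⟨bn α⟩(α,P')) ∈ →").  Being a set of α-equivalence
  -- classes is expressed by  ⟶-alpha : if π fixes every name of
  -- supp(α,P') = supp α ∪ supp P'  outside bn α, then the representative
  -- (π·bn α, π·(α,P')) = (bn(π·α), (π·α, π·P')) is also a transition.

  record NTS : Set₁ where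
    field
      STATES PRED ACT : Nominal
      _⊢_     : Carrier STATES → Carrier PRED → Set
      ⊢-eqvt  : ∀ π P φ → P ⊢ φ → act STATES π P ⊢ act PRED π φ
      bn      : Carrier ACT → List Name
      bn-eqvt : ∀ π α a → (a ∈ bn (act ACT π α) → a ∈ map (perm π) (bn α))
                        × (a ∈ map (perm π) (bn α) → a ∈ bn (act ACT π α))
      bn-supp : ∀ α a → a ∈ bn α → a ∈ supp ACT α
      _─_⟶_   : Carrier STATES → Carrier ACT → Carrier STATES → Set
      ⟶-eqvt  : ∀ π P α P' → P ─ α ⟶ P'
                → act STATES π P ─ act ACT π α ⟶ act STATES π P'
      ⟶-alpha : ∀ π P α P'
                → (∀ a → (a ∈ supp ACT α ⊎ a ∈ supp STATES P') → a ∉ bn α → perm π a ≡ a)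
                → P ─ α ⟶ P' → P ─ act ACT π α ⟶ act STATES π P'
      τ       : Carrier ACT
      τ-supp  : supp ACT τ ≡ []

  module Weak (T : NTS) where
    open NTS T

    State : Set
    State = Carrier STATES

    Act : Set
    Act = Carrier ACT

    data _⇒_ : State → State → Set where
      ⇒-refl : ∀ {P} → P ⇒ P
      ⇒-step : ∀ {P P'' P'} → P ─ τ ⟶ P'' → P'' ⇒ P' → P ⇒ P'

    _=[_]⇒_ : State → Act → State → Set
    P =[ α ]⇒ P' = ∃₂ λ P₁ P₂ → P ⇒ P₁ × P₁ ─ α ⟶ P₂ × P₂ ⇒ P'

    _=[_]⇒̂_ : State → Act → State → Set
    P =[ α ]⇒̂ P' = (α ≡ τ × P ⇒ P') ⊎ (¬ α ≡ τ × P =[ α ]⇒ P')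

    _#_ : List Name → State → Set
    N # Q = ∀ a → a ∈ N → a ∉ supp STATES Q

    record IsWeakBisimulation (R : State → State → Set) : Set where
      field
        symmetric : ∀ {P Q} → R P Q → R Q P
        weak-simulation : ∀ {P Q} → R P Q → ∀ α P' → bn α # Q → P ─ α ⟶ P'
                        → ∃ λ Q' → Q =[ α ]⇒̂ Q' × R P' Q'
        weak-static-implication : ∀ {P Q} → R P Q → ∀ φ → P ⊢ φ
                        → ∃ λ Q' → Q ⇒ Q' × Q' ⊢ φ × R P Q'

    _≈_ : State → State → Set₁
    P ≈ Q = Σ (State → State → Set) λ R → IsWeakBisimulation R × R P Q

  module _ (T : NTS) where
    open NTS T

    private
      bnS : Carrier (ACT ⊎ᴺ PRED) → List Name
      bnS (inj₁ α) = bn α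
      bnS (inj₂ φ) = []

      transS : Carrier STATES → Carrier (ACT ⊎ᴺ PRED) → Carrier STATES → Set
      transS P (inj₁ α) P' = P ─ α ⟶ P'
      transS P (inj₂ φ) P' = (P' ≡ P) × (P ⊢ φ)

    𝒮 : NTS
    𝒮 = record
      { STATES = STATES
      ; PRED = PRED
      ; ACT = ACT ⊎ᴺ PRED
      ; _⊢_ = λ _ _ → ⊥
      ; ⊢-eqvt = λ _ _ _ ()
      ; bn = bnS
      ; bn-eqvt = λ { π (inj₁ α) a → bn-eqvt π α a ; π (inj₂ φ) a → (λ ()) , (λ ()) }
      ; bn-supp = λ { (inj₁ α) a h → bn-supp α a h ; (inj₂ φ) a () }
      ; _─_⟶_ = transS
      ; ⟶-eqvt = λ { π P (inj₁ α) P' t → ⟶-eqvt π P α P' t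
                   ; π P (inj₂ φ) .P (refl , h) → refl , ⊢-eqvt π P φ h }
      ; ⟶-alpha = λ { π P (inj₁ α) P' f t → ⟶-alpha π P α P' f t
                    ; π P (inj₂ φ) .P f (refl , h) →
                        supp-supports STATES P π (λ a m → f a (inj₂ m) (λ ()))
                      , subst (P ⊢_) (sym (supp-supports PRED φ π (λ a m → f a (inj₁ m) (λ ())))) h }
      ; τ = inj₁ τ
      ; τ-supp = τ-supp
      }

module Submission where

-- Let R be a weak bisimulation of 𝒮(T).  Its equivariant closure is again a
-- weak bisimulation of 𝒮(T) (this holds in every nominal transition system),
-- so we may assume R equivariant.  A T-transition is a 𝒮(T)-transition, and a
-- state predicate φ of T is simulated in 𝒮(T) by  Q ⇒ Q₁ ─φ→ Q₁ ⇒ Q', which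
-- yields Q₁ ⊢ φ but relates P only to Q', not to Q₁.  We therefore relate P
-- to every state Y lying on a τ-path  W ⇒ Y ⇒ Z  between two states related
-- to P ("Between"), and close under symmetry.  Any state so related to P can
-- catch up by τ-steps with a state R-related to P (absorption of τ-steps by
-- a weak bisimulation), and from there a transition of P is matched after
-- α-renaming its binders away from the intermediate states.

open import Defs
open import Relation.Binary.Definitions using (DecidableEquality)
open import Data.Product using (Σ; _×_; _,_; proj₁; ∃)
open import Data.Sum using (_⊎_; inj₁; inj₂)
open import Data.Sum.Properties using (inj₁-injective)
open import Data.List using (List; []; _∷_; _++_; map)
open import Data.List.Membership.Propositional using (_∈_; _∉_)
open import Data.List.Membership.Propositional.Properties using (∈-map⁻; ∈-map⁺; ∈-++⁺ˡ; ∈-++⁺ʳ)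
open import Data.List.Relation.Unary.Any using (here; there)
open import Data.Nat using (ℕ; suc; _⊔_; _≤_)
open import Data.Nat.Properties using (m≤m⊔n; m≤n⊔m; ≤-trans; <-irrefl)
open import Data.Empty using (⊥-elim)
open import Relation.Nullary using (¬_; Dec; yes; no)
open import Relation.Binary.PropositionalEquality

module Development (Sort : Set) (_≟S_ : DecidableEquality Sort) where
  open NominalTheory Sort _≟S_
  open Nominal

  swap-left : ∀ a b e → swap ((a , b) , e) a ≡ b
  swap-left a b e with a ≟N a
  ... | yes _ = refl
  ... | no a≢a = ⊥-elim (a≢a refl)

  swap-right : ∀ a b e → swap ((a , b) , e) b ≡ a
  swap-right a b e with b ≟N a
  ... | yes b≡a = b≡a
  ... | no _ with b ≟N b
  ...   | yes _ = refl
  ...   | no b≢b = ⊥-elim (b≢b refl)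

  swap-other : ∀ a b e c → ¬ c ≡ a → ¬ c ≡ b → swap ((a , b) , e) c ≡ c
  swap-other a b e c c≢a c≢b with c ≟N a
  ... | yes c≡a = ⊥-elim (c≢a c≡a)
  ... | no _ with c ≟N b
  ...   | yes c≡b = ⊥-elim (c≢b c≡b)
  ...   | no _ = refl

  swap-involutive : ∀ s c → swap s (swap s c) ≡ c
  swap-involutive ((a , b) , e) c = by-cases (c ≟N a) (c ≟N b)
    where
    s : Swap
    s = ((a , b) , e)
    by-cases : Dec (c ≡ a) → Dec (c ≡ b) → swap s (swap s c) ≡ c
    by-cases (yes refl) _ = trans (cong (swap s) (swap-left a b e)) (swap-right a b e)
    by-cases (no _) (yes refl) = trans (cong (swap s) (swap-right a b e)) (swap-left a b e)
    by-cases (no c≢a) (no c≢b) =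
      trans (cong (swap s) (swap-other a b e c c≢a c≢b)) (swap-other a b e c c≢a c≢b)

  perm-++ : ∀ π σ a → perm (π ++ σ) a ≡ perm π (perm σ a)
  perm-++ [] σ a = refl
  perm-++ (s ∷ π) σ a = cong (swap s) (perm-++ π σ a)

  inv : Perm → Perm
  inv [] = []
  inv (s ∷ σ) = inv σ ++ (s ∷ [])

  perm-inv-l : ∀ σ a → perm (inv σ) (perm σ a) ≡ a
  perm-inv-l [] a = refl
  perm-inv-l (s ∷ σ) a = begin
    perm (inv σ ++ (s ∷ [])) (swap s (perm σ a)) ≡⟨ perm-++ (inv σ) (s ∷ []) _ ⟩
    perm (inv σ) (swap s (swap s (perm σ a)))    ≡⟨ cong (perm (inv σ)) (swap-involutive s _) ⟩
    perm (inv σ) (perm σ a)                       ≡⟨ perm-inv-l σ a ⟩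
    a                                             ∎
    where open ≡-Reasoning

  perm-inv-r : ∀ σ a → perm σ (perm (inv σ) a) ≡ a
  perm-inv-r [] a = refl
  perm-inv-r (s ∷ σ) a = begin
    swap s (perm σ (perm (inv σ ++ (s ∷ [])) a)) ≡⟨ cong (λ x → swap s (perm σ x)) (perm-++ (inv σ) (s ∷ []) a) ⟩
    swap s (perm σ (perm (inv σ) (swap s a)))    ≡⟨ cong (swap s) (perm-inv-r σ (swap s a)) ⟩
    swap s (swap s a)                            ≡⟨ swap-involutive s a ⟩
    a                                            ∎
    where open ≡-Reasoning

  perm-injective : ∀ σ {a b} → perm σ a ≡ perm σ b → a ≡ b
  perm-injective σ {a} {b} e =
    trans (sym (perm-inv-l σ a)) (trans (cong (perm (inv σ)) e) (perm-inv-l σ b))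

  module _ (X : Nominal) where
    act-inv-l : ∀ σ x → act X (inv σ) (act X σ x) ≡ x
    act-inv-l σ x = trans (sym (act-comp X (inv σ) σ x))
      (trans (act-ext X (inv σ ++ σ) [] (λ a → trans (perm-++ (inv σ) σ a) (perm-inv-l σ a)) x)
             (act-id X x))

    act-inv-r : ∀ σ x → act X σ (act X (inv σ) x) ≡ x
    act-inv-r σ x = trans (sym (act-comp X σ (inv σ) x))
      (trans (act-ext X (σ ++ inv σ) [] (λ a → trans (perm-++ σ (inv σ) a) (perm-inv-r σ a)) x)
             (act-id X x))

    empty-supp-fixed : ∀ x → supp X x ≡ [] → ∀ π → act X π x ≡ x
    empty-supp-fixed x e π = supp-supports X x π (λ a a∈ → ⊥-elim (∉[] (subst (a ∈_) e a∈)))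
      where
      ∉[] : ∀ {a : Name} → a ∉ []
      ∉[] ()

    -- Support is equivariant (one inclusion): σ · supp x supports σ · x,
    -- so it contains the least support of σ · x.
    supp-act : ∀ σ x a → a ∈ supp X (act X σ x) → a ∈ map (perm σ) (supp X x)
    supp-act σ x = supp-least X (act X σ x) (map (perm σ) (supp X x)) supports
      where
      supports : ∀ π → (∀ a → a ∈ map (perm σ) (supp X x) → perm π a ≡ a)
               → act X π (act X σ x) ≡ act X σ x
      supports π fix = begin
        act X π (act X σ x)                           ≡⟨ sym (act-inv-r σ _) ⟩
        act X σ (act X (inv σ) (act X π (act X σ x))) ≡⟨ cong (act X σ) conjugate-fixes ⟩
        act X σ x                                     ∎
        where
        open ≡-Reasoning
        conjugate-fixes : act X (inv σ) (act X π (act X σ x)) ≡ x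
        conjugate-fixes = begin
          act X (inv σ) (act X π (act X σ x)) ≡⟨ cong (act X (inv σ)) (sym (act-comp X π σ x)) ⟩
          act X (inv σ) (act X (π ++ σ) x)    ≡⟨ sym (act-comp X (inv σ) (π ++ σ) x) ⟩
          act X (inv σ ++ π ++ σ) x           ≡⟨ supp-supports X x _ fixes-supp ⟩
          x                                   ∎
          where
          fixes-supp : ∀ b → b ∈ supp X x → perm (inv σ ++ π ++ σ) b ≡ b
          fixes-supp b b∈ = begin
            perm (inv σ ++ π ++ σ) b          ≡⟨ perm-++ (inv σ) (π ++ σ) b ⟩
            perm (inv σ) (perm (π ++ σ) b)    ≡⟨ cong (perm (inv σ)) (perm-++ π σ b) ⟩
            perm (inv σ) (perm π (perm σ b))  ≡⟨ cong (perm (inv σ)) (fix _ (∈-map⁺ (perm σ) b∈)) ⟩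
            perm (inv σ) (perm σ b)           ≡⟨ perm-inv-l σ b ⟩
            b                                 ∎

  bound : List Name → ℕ
  bound [] = 0
  bound ((_ , n) ∷ L) = n ⊔ bound L

  ≤-bound : ∀ {s n} L → (s , n) ∈ L → n ≤ bound L
  ≤-bound ((_ , n) ∷ L) (here refl) = m≤m⊔n n (bound L)
  ≤-bound ((_ , n) ∷ L) (there m) = ≤-trans (≤-bound L m) (m≤n⊔m n (bound L))

  fresh-name-∉ : ∀ s L → (s , suc (bound L)) ∉ L
  fresh-name-∉ s L m = <-irrefl refl (≤-bound L m)

  record Renaming (B L : List Name) : Set where
    field
      π     : Perm
      fixes : ∀ a → a ∉ B → a ∈ L → perm π a ≡ a
      moves : ∀ b → b ∈ B → perm π b ∉ L

  -- Swap b with a fresh c of the same sort, then rename the rest of B away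
  -- from c ∷ L.
  rename-away : ∀ B L → Renaming B L
  rename-away [] L = record { π = [] ; fixes = λ _ _ _ → refl ; moves = λ _ () }
  rename-away (b ∷ B) L = record { π = π ++ (s ∷ []) ; fixes = fixes′ ; moves = moves′ }
    where
    c : Name
    c = (sort b , suc (bound (b ∷ B ++ L)))
    c-fresh : c ∉ b ∷ B ++ L
    c-fresh = fresh-name-∉ (sort b) (b ∷ B ++ L)
    c∉B : c ∉ B
    c∉B m = c-fresh (there (∈-++⁺ˡ m))
    c∉L : c ∉ L
    c∉L m = c-fresh (there (∈-++⁺ʳ B m))
    s : Swap
    s = ((b , c) , refl)
    open Renaming (rename-away B (c ∷ L))
    perm-π-s : ∀ a → perm (π ++ (s ∷ [])) a ≡ perm π (swap s a)
    perm-π-s a = perm-++ π (s ∷ []) a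
    fixes′ : ∀ a → a ∉ b ∷ B → a ∈ L → perm (π ++ (s ∷ [])) a ≡ a
    fixes′ a a∉ a∈ = begin
      perm (π ++ (s ∷ [])) a ≡⟨ perm-π-s a ⟩
      perm π (swap s a)      ≡⟨ cong (perm π) (swap-other b c refl a (λ e → a∉ (here e))
                                                 (λ e → c∉L (subst (_∈ L) e a∈))) ⟩
      perm π a               ≡⟨ fixes a (λ m → a∉ (there m)) (there a∈) ⟩
      a                      ∎
      where open ≡-Reasoning
    moves′ : ∀ b′ → b′ ∈ b ∷ B → perm (π ++ (s ∷ [])) b′ ∉ L
    moves′ b′ _ with b′ ≟N b
    moves′ b′ _ | yes refl = λ m → c∉L (subst (_∈ L) b↦c m)
      where
      b↦c : perm (π ++ (s ∷ [])) b ≡ c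
      b↦c = trans (perm-π-s b) (trans (cong (perm π) (swap-left b c refl)) (fixes c c∉B (here refl)))
    moves′ b′ (here b′≡b) | no b′≢b = ⊥-elim (b′≢b b′≡b)
    moves′ b′ (there b′∈B) | no b′≢b = λ m → moves b′ b′∈B (there (subst (_∈ L) b′↦πb′ m))
      where
      b′↦πb′ : perm (π ++ (s ∷ [])) b′ ≡ perm π b′
      b′↦πb′ = trans (perm-π-s b′)
        (cong (perm π) (swap-other b c refl b′ b′≢b (λ e → c∉B (subst (_∈ B) e b′∈B))))

  module WeakFacts (T : NTS) where
    open NTS T
    open Weak T

    _·_ : Perm → State → State
    _·_ = act STATES

    _·ₐ_ : Perm → Act → Act
    _·ₐ_ = act ACT

    τ-fixed : ∀ π → π ·ₐ τ ≡ τ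
    τ-fixed = empty-supp-fixed ACT τ τ-supp

    τ-fresh : ∀ Q → bn τ # Q
    τ-fresh Q a a∈ = ⊥-elim (∉[] (subst (a ∈_) τ-supp (bn-supp τ a a∈)))
      where
      ∉[] : ∀ {a : Name} → a ∉ []
      ∉[] ()

    ⇒-trans : ∀ {X Y Z} → X ⇒ Y → Y ⇒ Z → X ⇒ Z
    ⇒-trans ⇒-refl r = r
    ⇒-trans (⇒-step t r₁) r = ⇒-step t (⇒-trans r₁ r)

    ⇒-hat : ∀ {X Y Z α} → X ⇒ Y → Y =[ α ]⇒̂ Z → X =[ α ]⇒̂ Z
    ⇒-hat r (inj₁ (α≡τ , r′)) = inj₁ (α≡τ , ⇒-trans r r′)
    ⇒-hat r (inj₂ (α≢τ , (A , B , r₁ , t , r₂))) = inj₂ (α≢τ , (A , B , ⇒-trans r r₁ , t , r₂))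

    ⇒-eqvt : ∀ ρ {X Y} → X ⇒ Y → (ρ · X) ⇒ (ρ · Y)
    ⇒-eqvt ρ ⇒-refl = ⇒-refl
    ⇒-eqvt ρ (⇒-step {P} {P″} t r) =
      ⇒-step (subst (λ β → (ρ · P) ─ β ⟶ (ρ · P″)) (τ-fixed ρ) (⟶-eqvt ρ P τ P″ t)) (⇒-eqvt ρ r)

    hat-eqvt : ∀ ρ {X α Y} → X =[ α ]⇒̂ Y → (ρ · X) =[ ρ ·ₐ α ]⇒̂ (ρ · Y)
    hat-eqvt ρ (inj₁ (refl , r)) = inj₁ (τ-fixed ρ , ⇒-eqvt ρ r)
    hat-eqvt ρ {α = α} (inj₂ (α≢τ , (A , B , r₁ , t , r₂))) =
      inj₂ (ρα≢τ , (ρ · A , ρ · B , ⇒-eqvt ρ r₁ , ⟶-eqvt ρ A α B t , ⇒-eqvt ρ r₂))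
      where
      ρα≢τ : ¬ ρ ·ₐ α ≡ τ
      ρα≢τ e = α≢τ (trans (sym (act-inv-l ACT ρ α)) (trans (cong (inv ρ ·ₐ_) e) (τ-fixed (inv ρ))))

    ⇒-unpermute : ∀ σ {Y W} → (σ · Y) ⇒ W → Y ⇒ (inv σ · W)
    ⇒-unpermute σ {Y} r = subst (_⇒ _) (act-inv-l STATES σ Y) (⇒-eqvt (inv σ) r)

    hat-unpermute : ∀ σ {Y α W} → (σ · Y) =[ σ ·ₐ α ]⇒̂ W → Y =[ α ]⇒̂ (inv σ · W)
    hat-unpermute σ {Y} {α} h =
      subst₂ (λ Z β → Z =[ β ]⇒̂ _) (act-inv-l STATES σ Y) (act-inv-l ACT σ α) (hat-eqvt (inv σ) h)

    #-eqvt : ∀ σ {α Y} → bn α # Y → bn (σ ·ₐ α) # (σ · Y)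
    #-eqvt σ {α} {Y} fresh a a∈bn a∈supp
      with ∈-map⁻ (perm σ) (proj₁ (bn-eqvt σ α a) a∈bn)
         | ∈-map⁻ (perm σ) (supp-act STATES σ Y a a∈supp)
    ... | b , b∈bn , refl | c , c∈supp , σb≡σc =
      fresh b b∈bn (subst (_∈ supp STATES Y) (sym (perm-injective σ σb≡σc)) c∈supp)

    IsEquivariant : (State → State → Set) → Set
    IsEquivariant R = ∀ ρ {X Y} → R X Y → R (ρ · X) (ρ · Y)

    Closure : (State → State → Set) → State → State → Set
    Closure R X Y = Σ Perm λ σ → R (σ · X) (σ · Y)

    ⊆-closure : ∀ {R X Y} → R X Y → Closure R X Y
    ⊆-closure {R} {X} {Y} r = [] , subst₂ R (sym (act-id STATES X)) (sym (act-id STATES Y)) r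

    closure-equivariant : ∀ R → IsEquivariant (Closure R)
    closure-equivariant R ρ {X} {Y} (σ , r) =
      σ ++ inv ρ , subst₂ R (sym (cancel X)) (sym (cancel Y)) r
      where
      cancel : ∀ Z → ((σ ++ inv ρ) · (ρ · Z)) ≡ σ · Z
      cancel Z = trans (act-comp STATES σ (inv ρ) (ρ · Z)) (cong (σ ·_) (act-inv-l STATES ρ Z))

    -- The equivariant closure of a weak bisimulation is a weak bisimulation:
    -- permute, use R, and permute the answer back.
    closure-bisimulation : ∀ {R} → IsWeakBisimulation R → IsWeakBisimulation (Closure R)
    closure-bisimulation {R} bisim = record
      { symmetric = λ (σ , r) → σ , symmetric r
      ; weak-simulation = simulation
      ; weak-static-implication = static
      }
      where
      open IsWeakBisimulation bisim
      relate-back : ∀ σ {X W} → R (σ · X) W → Closure R X (inv σ · W)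
      relate-back σ r = σ , subst (R _) (sym (act-inv-r STATES σ _)) r

      simulation : ∀ {X Y} → Closure R X Y → ∀ α X′ → bn α # Y → X ─ α ⟶ X′
                 → ∃ λ Y′ → Y =[ α ]⇒̂ Y′ × Closure R X′ Y′
      simulation {X} {Y} (σ , r) α X′ fresh t
        with weak-simulation r (σ ·ₐ α) (σ · X′) (#-eqvt σ fresh) (⟶-eqvt σ X α X′ t)
      ... | W , h , r′ = inv σ · W , hat-unpermute σ h , relate-back σ r′

      static : ∀ {X Y} → Closure R X Y → ∀ φ → X ⊢ φ
             → ∃ λ Y′ → Y ⇒ Y′ × Y′ ⊢ φ × Closure R X Y′
      static {X} {Y} (σ , r) φ h with weak-static-implication r (act PRED σ φ) (⊢-eqvt σ X φ h)
      ... | W , r₁ , hW , r′ =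
        inv σ · W , ⇒-unpermute σ r₁ ,
        subst ((inv σ · W) ⊢_) (act-inv-l PRED σ φ) (⊢-eqvt (inv σ) W _ hW) , relate-back σ r′

    absorb-τ : ∀ {R} → IsWeakBisimulation R → ∀ {X W Y} → R X W → W ⇒ Y
             → ∃ λ X′ → X ⇒ X′ × R Y X′
    absorb-τ bisim {X} r ⇒-refl = X , ⇒-refl , IsWeakBisimulation.symmetric bisim r
    absorb-τ bisim {X} r (⇒-step {P'' = W″} t rest)
      with IsWeakBisimulation.weak-simulation bisim (IsWeakBisimulation.symmetric bisim r)
                                              τ W″ (τ-fresh X) t
    ... | X₁ , inj₂ (τ≢τ , _) , _ = ⊥-elim (τ≢τ refl)
    ... | X₁ , inj₁ (_ , r₁) , r′ with absorb-τ bisim (IsWeakBisimulation.symmetric bisim r′) rest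
    ...   | X′ , r₂ , r″ = X′ , ⇒-trans r₁ r₂ , r″

    alpha-rename : ∀ {X α X′} (L : List Name) → X ─ α ⟶ X′
      → Σ Perm λ π → X ─ π ·ₐ α ⟶ (π · X′)
                   × (∀ a → a ∈ bn (π ·ₐ α) → a ∉ L)
                   × (∀ a → a ∉ bn α → a ∈ L → perm π a ≡ a)
    alpha-rename {X} {α} {X′} L t =
      π , ⟶-alpha π X α X′ keeps-supp t , fresh , (λ a a∉ a∈ → fixes a a∉ (∈-++⁺ˡ a∈))
      where
      open Renaming (rename-away (bn α) (L ++ supp ACT α ++ supp STATES X′))
      keeps-supp : ∀ a → (a ∈ supp ACT α ⊎ a ∈ supp STATES X′) → a ∉ bn α → perm π a ≡ a
      keeps-supp a (inj₁ m) a∉ = fixes a a∉ (∈-++⁺ʳ L (∈-++⁺ˡ m))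
      keeps-supp a (inj₂ m) a∉ = fixes a a∉ (∈-++⁺ʳ L (∈-++⁺ʳ (supp ACT α) m))
      fresh : ∀ a → a ∈ bn (π ·ₐ α) → a ∉ L
      fresh a a∈ with ∈-map⁻ (perm π) (proj₁ (bn-eqvt π α a) a∈)
      ... | b , b∈ , refl = λ a∈L → moves b b∈ (∈-++⁺ˡ a∈L)

    -- Simulation from a state that reaches a related state by τ-steps, where
    -- the binders need only be fresh for the starting state: rename them away
    -- from both states, simulate, and rename back.
    simulate-after-τ : ∀ {R} → IsWeakBisimulation R → IsEquivariant R
      → ∀ {X Z Y α X′} → R X Z → Y ⇒ Z → bn α # Y → X ─ α ⟶ X′
      → ∃ λ Y′ → Y =[ α ]⇒̂ Y′ × R X′ Y′
    simulate-after-τ {R} bisim equivariant {X} {Z} {Y} {α} {X′} r yz fresh t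
      with alpha-rename (supp STATES Z ++ supp STATES Y) t
    ... | π , t′ , π-fresh , π-fixes
      with IsWeakBisimulation.weak-simulation bisim r (π ·ₐ α) (π · X′)
             (λ a a∈ a∈Z → π-fresh a a∈ (∈-++⁺ˡ a∈Z)) t′
    ...   | Z′ , h , r′ =
      inv π · Z′ ,
      hat-unpermute π (subst (λ V → V =[ π ·ₐ α ]⇒̂ Z′) (sym π-fixes-Y) (⇒-hat yz h)) ,
      subst (λ V → R V (inv π · Z′)) (act-inv-l STATES π X′) (equivariant (inv π) r′)
      where
      π-fixes-Y : π · Y ≡ Y
      π-fixes-Y = supp-supports STATES Y π
        (λ a a∈ → π-fixes a (λ a∈bn → fresh a a∈bn a∈) (∈-++⁺ʳ (supp STATES Z) a∈))

  module Saturated (T : NTS) where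
    open NTS T
    open Weak T
    module S = Weak (𝒮 T)
    module SF = WeakFacts (𝒮 T)

    ⇒-from-𝒮 : ∀ {X Y} → X S.⇒ Y → X ⇒ Y
    ⇒-from-𝒮 S.⇒-refl = ⇒-refl
    ⇒-from-𝒮 (S.⇒-step t r) = ⇒-step t (⇒-from-𝒮 r)

    hat-from-𝒮 : ∀ {X α Y} → X S.=[ inj₁ α ]⇒̂ Y → X =[ α ]⇒̂ Y
    hat-from-𝒮 (inj₁ (α≡τ , r)) = inj₁ (inj₁-injective α≡τ , ⇒-from-𝒮 r)
    hat-from-𝒮 (inj₂ (α≢τ , (A , B , r₁ , t , r₂))) =
      inj₂ ((λ e → α≢τ (cong inj₁ e)) , (A , B , ⇒-from-𝒮 r₁ , t , ⇒-from-𝒮 r₂))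

    -- A predicate of T is a loop transition in 𝒮(T); simulating it yields a
    -- τ-path through a state satisfying it to a related state.
    static-by-simulation : ∀ {R} → S.IsWeakBisimulation R → ∀ {X Y φ} → R X Y → X ⊢ φ
      → ∃ λ Y₁ → ∃ λ Y′ → Y S.⇒ Y₁ × Y₁ ⊢ φ × Y₁ S.⇒ Y′ × R X Y′
    static-by-simulation bisim {X} {φ = φ} r h
      with S.IsWeakBisimulation.weak-simulation bisim r (inj₂ φ) X (λ _ ()) (refl , h)
    ... | Y′ , inj₁ (() , _) , _
    ... | Y′ , inj₂ (_ , (Y₁ , _ , r₁ , (refl , h₁) , r₂)) , r′ = Y₁ , Y′ , r₁ , h₁ , r₂ , r′

    module _ (R : State → State → Set) (bisim : S.IsWeakBisimulation R)
             (equivariant : SF.IsEquivariant R) where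

      Between : State → State → Set
      Between X Y = Σ State λ W → Σ State λ Z → W S.⇒ Y × Y S.⇒ Z × R X W × R X Z

      Related : State → State → Set
      Related X Y = Between X Y ⊎ Between Y X

      between-refl : ∀ {X Y} → R X Y → Between X Y
      between-refl {Y = Y} r = Y , Y , S.⇒-refl , S.⇒-refl , r , r

      catch-up : ∀ {X Y} → Related X Y → ∃ λ Z → Y S.⇒ Z × R X Z
      catch-up (inj₁ (_ , Z , _ , yz , _ , xz)) = Z , yz , xz
      catch-up (inj₂ (_ , _ , wx , _ , yw , _)) = SF.absorb-τ bisim yw wx

      related-bisimulation : IsWeakBisimulation Related
      related-bisimulation = record
        { symmetric = λ { (inj₁ b) → inj₂ b ; (inj₂ b) → inj₁ b }
        ; weak-simulation = simulation
        ; weak-static-implication = static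
        }
        where
        simulation : ∀ {X Y} → Related X Y → ∀ α X′ → bn α # Y → X ─ α ⟶ X′
                   → ∃ λ Y′ → Y =[ α ]⇒̂ Y′ × Related X′ Y′
        simulation rel α X′ fresh t with catch-up rel
        ... | Z , yz , xz with SF.simulate-after-τ bisim equivariant xz yz fresh t
        ...   | Y′ , h , r′ = Y′ , hat-from-𝒮 h , inj₁ (between-refl r′)

        static : ∀ {X Y} → Related X Y → ∀ φ → X ⊢ φ
               → ∃ λ Y′ → Y ⇒ Y′ × Y′ ⊢ φ × Related X Y′
        static rel φ h with catch-up rel
        ... | Z , yz , xz with static-by-simulation bisim xz h
        ...   | Y₁ , Z′ , zy₁ , h₁ , y₁z′ , xz′ =
          Y₁ , ⇒-from-𝒮 (SF.⇒-trans yz zy₁) , h₁ , inj₁ (Z , Z′ , zy₁ , y₁z′ , xz , xz′)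

theorem8p8 : (Sort : Set) (_≟_ : DecidableEquality Sort)
    → let open NominalTheory Sort _≟_ in
    (T : NTS) (P Q : Nominal.Carrier (NTS.STATES T))
    → Weak._≈_ (𝒮 T) P Q → Weak._≈_ T P Q
theorem8p8 Sort _≟_ T P Q (R , bisim , r) =
  Related R̄ bisim̄ equivariant , related-bisimulation R̄ bisim̄ equivariant ,
  inj₁ (between-refl R̄ bisim̄ equivariant (SF.⊆-closure {R} r))
  where
  open Development Sort _≟_
  open Saturated T
  R̄ : S.State → S.State → Set
  R̄ = SF.Closure R
  bisim̄ : S.IsWeakBisimulation R̄
  bisim̄ = SF.closure-bisimulation bisim
  equivariant : SF.IsEquivariant R̄
  equivariant = SF.closure-equivariant R
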